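{- Let $\Gamma$ be an infinite abelian group and $F\colon\Gamma\to\Gamma$ an injective endomorphism, and let $A\subseteq\Gamma$ be $F$-automatic. Then for every $r>0$ and every $F^r$-spanning set $\Sigma$, the language $\{\sigma\in\Sigma^*:[\sigma]_{F^r}\in A\}$ over the alphabet $\Sigma$ is regular.
   Context: For a string $\sigma=s_0\cdots s_n$ of elements of $\Gamma$ and an endomorphism $G$, $[\sigma]_G=s_0+Gs_1+\cdots+G^ns_n$. $\Lambda^*$ denotes finite strings over $\Lambda$. A finite $\Sigma\subseteq\Gamma$ is a $G$-spanning set if: (i) every $a\in\Gamma$ equals $[\sigma]_G$ for some $\sigma\in\Sigma^*$; (ii) $0\in\Sigma$ and $\Sigma=-\Sigma$; (iii) for $a_1,\dots,a_5\in\Sigma$, $a_1+\cdots+a_5\in\Sigma+G\Sigma$; (iv) if $a_1,a_2,a_3\in\Sigma$ and $a_1+a_2+a_3\in G\Gamma$ then $a_1+a_2+a_3\in G\Sigma$. $A\subseteq\Gamma$ is $F$-automatic if there are $r'>0$ and an $F^{r'}$-spanning set $\Sigma'$ such that $\{\sigma\in\Sigma'^*:[\sigma]_{F^{r'}}\in A\}$ is regular. -}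

module Defs where

open import Level using (Level; _⊔_; Lift)
open import Data.Sum using (_⊎_)
open import Data.Nat using (ℕ; zero; suc; _<_)
open import Data.Fin using (Fin)
open import Data.List using (List; []; _∷_)
open import Data.Bool using (Bool; true)
open import Data.Product using (Σ; ∃; _×_; _,_)
open import Data.Empty using (⊥)
open import Relation.Nullary using (¬_)
open import Relation.Binary.PropositionalEquality using (_≡_)
open import Function.Bundles using (_⇔_)
open import Algebra.Bundles using (AbelianGroup)
open import Algebra.Morphism.Structures using (module GroupMorphisms)

record DFA (k : ℕ) : Set where
  field
    states : ℕ
    start  : Fin states
    step   : Fin states → Fin k → Fin states
    accept : Fin states → Bool

  run : Fin states → List (Fin k) → Fin states
  run q []      = q
  run q (a ∷ w) = run (step q a) w

  Accepts : List (Fin k) → Set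
  Accepts w = accept (run start w) ≡ true

IsRegular : ∀ {p} {k : ℕ} → (List (Fin k) → Set p) → Set p
IsRegular {k = k} L = Σ (DFA k) λ M → ∀ w → L w ⇔ DFA.Accepts M w

iter : ∀ {a} {A : Set a} → (A → A) → ℕ → A → A
iter f zero    x = x
iter f (suc n) x = f (iter f n x)

module _ {c ℓ : Level} (Γ : AbelianGroup c ℓ) where
  open AbelianGroup Γ renaming (Carrier to G₀)

  IsInjectiveEndo : (G₀ → G₀) → Set (c ⊔ ℓ)
  IsInjectiveEndo F = GroupMorphisms.IsGroupMonomorphism rawGroup rawGroup F

  IsInfinite : Set (c ⊔ ℓ)
  IsInfinite = ¬ (Σ (List G₀) λ xs → ∀ x → AnyEq x xs)
    where
    AnyEq : G₀ → List G₀ → Set ℓ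
    AnyEq x []       = Lift ℓ ⊥
    AnyEq x (y ∷ ys) = (x ≈ y) ⊎ AnyEq x ys

  -- [s₀ s₁ ⋯ sₙ]_G = s₀ + G s₁ + ⋯ + Gⁿ sₙ, where the string is over
  -- the alphabet Fin k, letter i standing for the group element Sig i.
  evalFrom : (G : G₀ → G₀) {k : ℕ} (Sig : Fin k → G₀) → ℕ → List (Fin k) → G₀
  evalFrom G Sig j []      = ε
  evalFrom G Sig j (i ∷ σ) = iter G j (Sig i) ∙ evalFrom G Sig (suc j) σ

  ⟦_⟧[_,_] : {k : ℕ} → List (Fin k) → (G₀ → G₀) → (Fin k → G₀) → G₀
  ⟦ σ ⟧[ G , Sig ] = evalFrom G Sig 0 σ

  -- A finite subset Σ ⊆ Γ, enumerated without repetition by Sig : Fin k → Γ.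
  IsEnumeration : {k : ℕ} → (Fin k → G₀) → Set ℓ
  IsEnumeration Sig = ∀ i j → Sig i ≈ Sig j → i ≡ j

  record IsSpanning (G : G₀ → G₀) {k : ℕ} (Sig : Fin k → G₀) : Set (c ⊔ ℓ) where
    field
      spans     : ∀ a → ∃ λ (σ : List (Fin k)) → ⟦ σ ⟧[ G , Sig ] ≈ a
      hasZero   : ∃ λ i → Sig i ≈ ε
      symmetric : ∀ i → ∃ λ j → Sig j ≈ Sig i ⁻¹
      five      : ∀ i₁ i₂ i₃ i₄ i₅ → ∃ λ j → ∃ λ l →
                    Sig i₁ ∙ Sig i₂ ∙ Sig i₃ ∙ Sig i₄ ∙ Sig i₅ ≈ Sig j ∙ G (Sig l)
      three     : ∀ i₁ i₂ i₃ → (∃ λ b → Sig i₁ ∙ Sig i₂ ∙ Sig i₃ ≈ G b) →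
                    ∃ λ j → Sig i₁ ∙ Sig i₂ ∙ Sig i₃ ≈ G (Sig j)

  Lang : ∀ {p} (F : G₀ → G₀) (r : ℕ) {k : ℕ} (Sig : Fin k → G₀) (A : G₀ → Set p) →
         List (Fin k) → Set p
  Lang F r Sig A σ = A ⟦ σ ⟧[ iter F r , Sig ]

  IsAutomatic : ∀ {p} (F : G₀ → G₀) (A : G₀ → Set p) → Set (c ⊔ ℓ ⊔ p)
  IsAutomatic F A = Σ ℕ λ r′ → 0 < r′ × Σ ℕ λ k → Σ (Fin k → G₀) λ Sig →
                      IsEnumeration Sig × IsSpanning (iter F r′) Sig ×
                      IsRegular (Lang F r′ Sig A)

  RespectsEq : ∀ {p} → (G₀ → Set p) → Set (c ⊔ ℓ ⊔ p)
  RespectsEq A = ∀ {x y} → x ≈ y → A x → A y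

module Submission where

-- A word over Σ is read in blocks of n letters, where Fⁿ is the base of the automaton M′ over the
-- Fⁿ-spanning set Σ′ that witnesses automaticity. Since (Fʳ)ⁿ = (Fⁿ)ʳ, consecutive blocks contribute
-- at Fⁿ-positions r apart, and each of the finitely many blocks has a Σ′-expansion in base Fⁿ of
-- bounded length. A finite-state transducer keeps a fixed-length buffer of Σ′-digits: after each
-- block it adds the block's expansion to the buffer digit by digit, carries being single letters by
-- condition (iii), feeds the lowest r digits to M′ and keeps the rest, which fits the buffer again
-- because r ≥ 1.

open import Defs
open import Level using (Level)
open import Data.Bool using (Bool; true)
open import Data.Nat using (ℕ; zero; suc; _+_; _*_; _<_; _≤_; _<?_; z≤n; s≤s)
import Data.Nat.Properties as ℕ
open import Data.Fin using (Fin; zero; suc; toℕ; fromℕ<)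
open import Data.Fin.Properties using (*↔×; toℕ-fromℕ<; toℕ<n; <⇒≢)
open import Data.List using (List; []; _∷_; _++_; length; map; allFin)
open import Data.List.Extrema.Nat using (max; xs≤max)
open import Data.List.Membership.Propositional.Properties using (∈-map⁺; ∈-allFin)
import Data.List.Relation.Unary.All as All
open import Data.Vec as Vec
  using (Vec; []; _∷_; toList; fromList; replicate; lookup; _[_]≔_; padRight; take; drop)
open import Data.Vec.Properties
  using (toList-++; take++drop≡id; length-toList; toList∘fromList; lookup∘update′; lookup-replicate)
open import Data.Product using (Σ; ∃; _×_; _,_; proj₁; proj₂; uncurry)
open import Data.Product.Function.NonDependent.Propositional using (_×-↪_)
open import Function using (_∘_; const)
open import Function.Bundles using (_⇔_; _↪_; _↔_; mk⇔; mk↪; mk↔ₛ′; RightInverse)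
open import Function.Construct.Composition using (_↪-∘_; _⇔-∘_)
open import Function.Construct.Identity using (↪-id)
open import Function.Construct.Symmetry using (↔-sym)
open import Function.Properties.Inverse using (↔⇒↪)
open import Relation.Nullary using (Dec; yes; no)
open import Relation.Binary.PropositionalEquality as ≡ using (_≡_; ≢-sym)
open import Algebra.Bundles using (AbelianGroup)
open import Algebra.Morphism.Structures using (module MonoidMorphisms; module GroupMorphisms)
import Algebra.Morphism.Construct.Composition as Compose
import Algebra.Morphism.Construct.Identity as Identity
import Algebra.Properties.CommutativeSemigroup as CommutativeSemigroupProperties
import Relation.Binary.Reasoning.Setoid as SetoidReasoning

iter-+ : ∀ {a} {A : Set a} (f : A → A) m n x → iter f m (iter f n x) ≡ iter f (m + n) x
iter-+ f zero    n x = ≡.refl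
iter-+ f (suc m) n x = ≡.cong f (iter-+ f m n x)

iter-* : ∀ {a} {A : Set a} (f : A → A) m n x → iter (iter f m) n x ≡ iter f (n * m) x
iter-* f m zero    x = ≡.refl
iter-* f m (suc n) x = ≡.trans (≡.cong (iter f m) (iter-* f m n x)) (iter-+ f m (n * m) x)

iter-iter-comm : ∀ {a} {A : Set a} (f : A → A) m n x → iter (iter f m) n x ≡ iter (iter f n) m x
iter-iter-comm f m n x = begin
  iter (iter f m) n x ≡⟨ iter-* f m n x ⟩
  iter f (n * m) x    ≡⟨ ≡.cong (λ e → iter f e x) (ℕ.*-comm n m) ⟩
  iter f (m * n) x    ≡⟨ ≡.sym (iter-* f n m x) ⟩
  iter (iter f n) m x ∎
  where open ≡.≡-Reasoning

Finite : Set → Set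
Finite S = Σ ℕ λ n → S ↪ Fin n

Fin-finite : ∀ n → Finite (Fin n)
Fin-finite n = n , ↪-id (Fin n)

×-finite : ∀ {S T} → Finite S → Finite T → Finite (S × T)
×-finite (m , S↪) (n , T↪) = m * n , ↔⇒↪ (↔-sym *↔×) ↪-∘ (S↪ ×-↪ T↪)

Vec-suc↔× : ∀ {S : Set} {n} → Vec S (suc n) ↔ (S × Vec S n)
Vec-suc↔× = mk↔ₛ′ Vec.uncons (uncurry _∷_) (λ _ → ≡.refl) λ { (x ∷ xs) → ≡.refl }

Vec-finite : ∀ {S} → Finite S → ∀ n → Finite (Vec S n)
Vec-finite S-fin zero    = 1 , mk↪ {to = const zero} {from = const []} λ { {[]} _ → ≡.refl }
Vec-finite S-fin (suc n) with ×-finite S-fin (Vec-finite S-fin n)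
... | m , S×Vec↪ = m , S×Vec↪ ↪-∘ ↔⇒↪ Vec-suc↔×

finite-bounded : ∀ {S} → Finite S → (g : S → ℕ) → Σ ℕ λ K → ∀ x → g x ≤ K
finite-bounded (n , S↪) g = K , bound
  where
  open RightInverse S↪
  K : ℕ
  K = max 0 (map (g ∘ from) (allFin n))
  bound : ∀ x → g x ≤ K
  bound x = ≡.subst (_≤ K) (≡.cong g (strictlyInverseʳ x))
              (All.lookup (xs≤max 0 _) (∈-map⁺ (g ∘ from) (∈-allFin (to x))))

record Automaton (k : ℕ) (S : Set) : Set where
  field
    start  : S
    step   : S → Fin k → S
    accept : S → Bool

  run : S → List (Fin k) → S
  run q []      = q
  run q (a ∷ w) = run (step q a) w

  Accepts : List (Fin k) → Set
  Accepts w = accept (run start w) ≡ true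

module _ {k : ℕ} {S : Set} (S-fin : Finite S) (M : Automaton k S) where
  open Automaton M
  private
    n : ℕ
    n = proj₁ S-fin
    open RightInverse (proj₂ S-fin)

  toDFA : DFA k
  toDFA = record
    { states = n
    ; start  = to start
    ; step   = λ q a → to (step (from q) a)
    ; accept = accept ∘ from
    }

  toDFA-run : ∀ q w → from (DFA.run toDFA (to q) w) ≡ run q w
  toDFA-run q []      = strictlyInverseʳ q
  toDFA-run q (a ∷ w) rewrite strictlyInverseʳ q = toDFA-run (step q a) w

  finite-automaton-isRegular : IsRegular Accepts
  finite-automaton-isRegular = toDFA , λ w → mk⇔ (≡.trans (same-run w)) (≡.trans (≡.sym (same-run w)))
    where
    same-run : ∀ w → DFA.accept toDFA (DFA.run toDFA (to start) w) ≡ accept (run start w)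
    same-run w = ≡.cong accept (toDFA-run start w)

isRegular-resp-⇔ : ∀ {p q k} {L : List (Fin k) → Set p} {L′ : List (Fin k) → Set q} →
                   (∀ w → L′ w ⇔ L w) → IsRegular L → IsRegular L′
isRegular-resp-⇔ L′⇔L (M , L⇔M) = M , λ w → L⇔M w ⇔-∘ L′⇔L w

DFA-run-++ : ∀ {k} (M : DFA k) q u v → DFA.run M q (u ++ v) ≡ DFA.run M (DFA.run M q u) v
DFA-run-++ M q []      v = ≡.refl
DFA-run-++ M q (a ∷ u) v = DFA-run-++ M (DFA.step M q a) u v

module _ {c ℓ : Level} (Γ : AbelianGroup c ℓ) where
  open AbelianGroup Γ renaming (Carrier to G₀)
  open MonoidMorphisms rawMonoid rawMonoid using (IsMonoidHomomorphism)
  open SetoidReasoning setoid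
  open CommutativeSemigroupProperties commutativeSemigroup using (interchange)

  iter-isMonoidHomomorphism : ∀ {f} → IsMonoidHomomorphism f → ∀ n → IsMonoidHomomorphism (iter f n)
  iter-isMonoidHomomorphism f-homo zero    = Identity.isMonoidHomomorphism rawMonoid refl
  iter-isMonoidHomomorphism f-homo (suc n) =
    Compose.isMonoidHomomorphism trans (iter-isMonoidHomomorphism f-homo n) f-homo

  spanning-add₃ : ∀ {G k} {Sig : Fin k → G₀} → IsSpanning Γ G Sig →
                  ∀ a b c → ∃ λ d → ∃ λ e → Sig a ∙ Sig b ∙ Sig c ≈ Sig d ∙ G (Sig e)
  spanning-add₃ {G} {Sig = Sig} sp a b c with IsSpanning.hasZero sp
  ... | z , z≈ε with IsSpanning.five sp a b c z z
  ... | d , e , sum₅≈ = d , e , (begin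
    Sig a ∙ Sig b ∙ Sig c                 ≈⟨ identityʳ _ ⟨
    Sig a ∙ Sig b ∙ Sig c ∙ ε             ≈⟨ ∙-congˡ z≈ε ⟨
    Sig a ∙ Sig b ∙ Sig c ∙ Sig z         ≈⟨ identityʳ _ ⟨
    Sig a ∙ Sig b ∙ Sig c ∙ Sig z ∙ ε     ≈⟨ ∙-congˡ z≈ε ⟨
    Sig a ∙ Sig b ∙ Sig c ∙ Sig z ∙ Sig z ≈⟨ sum₅≈ ⟩
    Sig d ∙ G (Sig e)                     ∎)

  module Evaluation {G : G₀ → G₀} (G-homo : IsMonoidHomomorphism G) {k : ℕ} (Sig : Fin k → G₀) where
    open IsMonoidHomomorphism G-homo using (homo; ε-homo; ⟦⟧-cong)

    ⟦_⟧ : List (Fin k) → G₀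
    ⟦_⟧ = evalFrom Γ G Sig 0

    evalFrom-suc : ∀ j σ → evalFrom Γ G Sig (suc j) σ ≈ G (evalFrom Γ G Sig j σ)
    evalFrom-suc j []      = sym ε-homo
    evalFrom-suc j (i ∷ σ) = begin
      G (iter G j (Sig i)) ∙ evalFrom Γ G Sig (suc (suc j)) σ ≈⟨ ∙-congˡ (evalFrom-suc (suc j) σ) ⟩
      G (iter G j (Sig i)) ∙ G (evalFrom Γ G Sig (suc j) σ)   ≈⟨ homo _ _ ⟨
      G (iter G j (Sig i) ∙ evalFrom Γ G Sig (suc j) σ)       ∎

    ⟦∷⟧ : ∀ i σ → ⟦ i ∷ σ ⟧ ≈ Sig i ∙ G ⟦ σ ⟧
    ⟦∷⟧ i σ = ∙-congˡ (evalFrom-suc 0 σ)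

    evalFrom≈iter : ∀ j σ → evalFrom Γ G Sig j σ ≈ iter G j ⟦ σ ⟧
    evalFrom≈iter zero    σ = refl
    evalFrom≈iter (suc j) σ = trans (evalFrom-suc j σ) (⟦⟧-cong (evalFrom≈iter j σ))

    iter-⟦∷⟧ : ∀ j i σ → iter G j ⟦ i ∷ σ ⟧ ≈ iter G j (Sig i) ∙ iter G (suc j) ⟦ σ ⟧
    iter-⟦∷⟧ j i σ = trans (sym (evalFrom≈iter j (i ∷ σ))) (∙-congˡ (evalFrom≈iter (suc j) σ))

    ⟦++⟧ : ∀ σ τ → ⟦ σ ++ τ ⟧ ≈ ⟦ σ ⟧ ∙ iter G (length σ) ⟦ τ ⟧
    ⟦++⟧ []      τ = sym (identityˡ _)
    ⟦++⟧ (i ∷ σ) τ = begin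
      ⟦ i ∷ σ ++ τ ⟧                                  ≈⟨ ⟦∷⟧ i (σ ++ τ) ⟩
      Sig i ∙ G ⟦ σ ++ τ ⟧                            ≈⟨ ∙-congˡ (⟦⟧-cong (⟦++⟧ σ τ)) ⟩
      Sig i ∙ G (⟦ σ ⟧ ∙ iter G (length σ) ⟦ τ ⟧)     ≈⟨ ∙-congˡ (homo _ _) ⟩
      Sig i ∙ (G ⟦ σ ⟧ ∙ iter G (suc (length σ)) ⟦ τ ⟧) ≈⟨ assoc _ _ _ ⟨
      Sig i ∙ G ⟦ σ ⟧ ∙ iter G (suc (length σ)) ⟦ τ ⟧ ≈⟨ ∙-congʳ (⟦∷⟧ i σ) ⟨
      ⟦ i ∷ σ ⟧ ∙ iter G (length (i ∷ σ)) ⟦ τ ⟧        ∎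

    ⟦take⟧∙⟦drop⟧ : ∀ m {n} (xs : Vec (Fin k) (m + n)) →
                    ⟦ toList (take m xs) ⟧ ∙ iter G m ⟦ toList (drop m xs) ⟧ ≈ ⟦ toList xs ⟧
    ⟦take⟧∙⟦drop⟧ m {n} xs = begin
      ⟦ toList ys ⟧ ∙ iter G m ⟦ toList zs ⟧
        ≡⟨ ≡.cong (λ l → ⟦ toList ys ⟧ ∙ iter G l ⟦ toList zs ⟧) (length-toList ys) ⟨
      ⟦ toList ys ⟧ ∙ iter G (length (toList ys)) ⟦ toList zs ⟧ ≈⟨ ⟦++⟧ (toList ys) (toList zs) ⟨
      ⟦ toList ys ++ toList zs ⟧ ≡⟨ ≡.cong ⟦_⟧ (toList-++ ys zs) ⟨
      ⟦ toList (ys Vec.++ zs) ⟧  ≡⟨ ≡.cong (⟦_⟧ ∘ toList) (take++drop≡id m xs) ⟩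
      ⟦ toList xs ⟧              ∎
      where
      ys : Vec (Fin k) m
      ys = take m xs
      zs : Vec (Fin k) n
      zs = drop m xs

    module ZeroLetter (z : Fin k) (z≈ε : Sig z ≈ ε) where

      iter-z≈ε : ∀ j → iter G j (Sig z) ≈ ε
      iter-z≈ε j = trans (Gʲ.⟦⟧-cong z≈ε) Gʲ.ε-homo
        where module Gʲ = IsMonoidHomomorphism (iter-isMonoidHomomorphism G-homo j)

      ⟦replicate⟧ : ∀ n → ⟦ toList (replicate n z) ⟧ ≈ ε
      ⟦replicate⟧ zero    = refl
      ⟦replicate⟧ (suc n) = begin
        ⟦ z ∷ toList (replicate n z) ⟧     ≈⟨ ⟦∷⟧ z (toList (replicate n z)) ⟩
        Sig z ∙ G ⟦ toList (replicate n z) ⟧ ≈⟨ ∙-cong z≈ε (⟦⟧-cong (⟦replicate⟧ n)) ⟩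
        ε ∙ G ε                             ≈⟨ identityˡ _ ⟩
        G ε                                 ≈⟨ ε-homo ⟩
        ε                                   ∎

      ⟦padRight⟧ : ∀ {m n} (m≤n : m ≤ n) (xs : Vec (Fin k) m) →
                   ⟦ toList (padRight m≤n z xs) ⟧ ≈ ⟦ toList xs ⟧
      ⟦padRight⟧ {n = n} z≤n [] = ⟦replicate⟧ n
      ⟦padRight⟧ (s≤s m≤n) (x ∷ xs) = begin
        ⟦ x ∷ toList (padRight m≤n z xs) ⟧     ≈⟨ ⟦∷⟧ x (toList (padRight m≤n z xs)) ⟩
        Sig x ∙ G ⟦ toList (padRight m≤n z xs) ⟧ ≈⟨ ∙-congˡ (⟦⟧-cong (⟦padRight⟧ m≤n xs)) ⟩
        Sig x ∙ G ⟦ toList xs ⟧                 ≈⟨ ⟦∷⟧ x (toList xs) ⟨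
        ⟦ x ∷ toList xs ⟧                       ∎

      evalFrom-≔ : ∀ {n} j (xs : Vec (Fin k) n) i s → lookup xs i ≡ z →
                   evalFrom Γ G Sig j (toList (xs [ i ]≔ s)) ≈
                   evalFrom Γ G Sig j (toList xs) ∙ iter G (j + toℕ i) (Sig s)
      evalFrom-≔ j (x ∷ xs) zero s ≡.refl = begin
        iter G j (Sig s) ∙ rest
          ≈⟨ comm _ _ ⟩
        rest ∙ iter G j (Sig s)
          ≈⟨ ∙-congʳ (trans (∙-congʳ (iter-z≈ε j)) (identityˡ rest)) ⟨
        iter G j (Sig z) ∙ rest ∙ iter G j (Sig s)
          ≡⟨ ≡.cong (λ e → iter G j (Sig z) ∙ rest ∙ iter G e (Sig s)) (ℕ.+-identityʳ j) ⟨
        iter G j (Sig z) ∙ rest ∙ iter G (j + 0) (Sig s) ∎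
        where
        rest : G₀
        rest = evalFrom Γ G Sig (suc j) (toList xs)
      evalFrom-≔ j (x ∷ xs) (suc i) s xs[i]≡z = begin
        iter G j (Sig x) ∙ evalFrom Γ G Sig (suc j) (toList (xs [ i ]≔ s))
          ≈⟨ ∙-congˡ (evalFrom-≔ (suc j) xs i s xs[i]≡z) ⟩
        iter G j (Sig x) ∙ (evalFrom Γ G Sig (suc j) (toList xs) ∙ iter G (suc j + toℕ i) (Sig s))
          ≈⟨ assoc _ _ _ ⟨
        iter G j (Sig x) ∙ evalFrom Γ G Sig (suc j) (toList xs) ∙ iter G (suc j + toℕ i) (Sig s)
          ≡⟨ ≡.cong (λ e → iter G j (Sig x) ∙ evalFrom Γ G Sig (suc j) (toList xs) ∙ iter G e (Sig s))
                    (ℕ.+-suc j (toℕ i)) ⟨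
        iter G j (Sig x) ∙ evalFrom Γ G Sig (suc j) (toList xs) ∙ iter G (j + suc (toℕ i)) (Sig s) ∎

    module CarryAddition
      (add₃ : ∀ a b c → ∃ λ d → ∃ λ e → Sig a ∙ Sig b ∙ Sig c ≈ Sig d ∙ G (Sig e))
      where

      digit carry : Fin k → Fin k → Fin k → Fin k
      digit c a b = proj₁ (add₃ c a b)
      carry c a b = proj₁ (proj₂ (add₃ c a b))

      addWithCarry : ∀ {n} → Fin k → Vec (Fin k) n → Vec (Fin k) n → Vec (Fin k) (suc n)
      addWithCarry c []      []      = c ∷ []
      addWithCarry c (a ∷ x) (b ∷ y) = digit c a b ∷ addWithCarry (carry c a b) x y

      ⟦addWithCarry⟧ : ∀ {n} c (x y : Vec (Fin k) n) →
                       ⟦ toList (addWithCarry c x y) ⟧ ≈ Sig c ∙ ⟦ toList x ⟧ ∙ ⟦ toList y ⟧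
      ⟦addWithCarry⟧ c []      []      = sym (identityʳ _)
      ⟦addWithCarry⟧ c (a ∷ x) (b ∷ y) = begin
        ⟦ d ∷ toList (addWithCarry e x y) ⟧           ≈⟨ ⟦∷⟧ d (toList (addWithCarry e x y)) ⟩
        Sig d ∙ G ⟦ toList (addWithCarry e x y) ⟧     ≈⟨ ∙-congˡ (⟦⟧-cong (⟦addWithCarry⟧ e x y)) ⟩
        Sig d ∙ G (Sig e ∙ X ∙ Y)                     ≈⟨ ∙-congˡ (trans (homo _ _) (∙-congʳ (homo _ _))) ⟩
        Sig d ∙ (G (Sig e) ∙ G X ∙ G Y)               ≈⟨ ∙-congˡ (assoc _ _ _) ⟩
        Sig d ∙ (G (Sig e) ∙ (G X ∙ G Y))             ≈⟨ assoc _ _ _ ⟨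
        Sig d ∙ G (Sig e) ∙ (G X ∙ G Y)               ≈⟨ ∙-congʳ (proj₂ (proj₂ (add₃ c a b))) ⟨
        Sig c ∙ Sig a ∙ Sig b ∙ (G X ∙ G Y)           ≈⟨ interchange _ _ _ _ ⟩
        Sig c ∙ Sig a ∙ G X ∙ (Sig b ∙ G Y)           ≈⟨ ∙-cong (trans (assoc _ _ _) (∙-congˡ (sym (⟦∷⟧ a (toList x)))))
                                                                (sym (⟦∷⟧ b (toList y))) ⟩
        Sig c ∙ ⟦ a ∷ toList x ⟧ ∙ ⟦ b ∷ toList y ⟧   ∎
        where
        d e : Fin k
        d = digit c a b
        e = carry c a b
        X Y : G₀
        X = ⟦ toList x ⟧
        Y = ⟦ toList y ⟧

  module BaseChange
    {F : G₀ → G₀} (F-homo : IsMonoidHomomorphism F) {p : Level}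
    {A : G₀ → Set p} (A-resp : RespectsEq Γ A)
    (n₀ : ℕ) {k′ : ℕ} {Sig′ : Fin k′ → G₀} (Sig′-spanning : IsSpanning Γ (iter F (suc n₀)) Sig′)
    (M′ : DFA k′) (M′-recognises : ∀ ω → Lang Γ F (suc n₀) Sig′ A ω ⇔ DFA.Accepts M′ ω)
    (r₀ : ℕ) {k : ℕ} (Sig : Fin k → G₀) (z : Fin k) (z≈ε : Sig z ≈ ε)
    where

    n r : ℕ
    n = suc n₀
    r = suc r₀

    Fⁿ Fʳ : G₀ → G₀
    Fⁿ = iter F n
    Fʳ = iter F r

    Fⁿ-homo : IsMonoidHomomorphism Fⁿ
    Fⁿ-homo = iter-isMonoidHomomorphism F-homo n

    Fʳ-homo : IsMonoidHomomorphism Fʳ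
    Fʳ-homo = iter-isMonoidHomomorphism F-homo r

    module Fⁿʳ = IsMonoidHomomorphism (iter-isMonoidHomomorphism Fⁿ-homo r)

    module In  = Evaluation Fʳ-homo Sig
    module Out = Evaluation Fⁿ-homo Sig′
    open IsSpanning Sig′-spanning using (spans; hasZero)

    z′ : Fin k′
    z′ = proj₁ hasZero

    module In₀  = In.ZeroLetter z z≈ε
    module Out₀ = Out.ZeroLetter z′ (proj₂ hasZero)
    open Out.CarryAddition (spanning-add₃ Sig′-spanning) using (addWithCarry; ⟦addWithCarry⟧)

    Block : Set
    Block = Vec (Fin k) n

    blockValue : Block → G₀
    blockValue β = In.⟦ toList β ⟧

    blockDigits : Block → List (Fin k′)
    blockDigits β = proj₁ (spans (blockValue β))

    -- Opaque, or typechecking evaluates K, a maximum over all blocks, whenever a padded block is normalised.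
    opaque
      blockDigits-bounded : Σ ℕ λ K → ∀ β → length (blockDigits β) ≤ K
      blockDigits-bounded = finite-bounded (Vec-finite (Fin-finite k) n) (length ∘ blockDigits)

    K : ℕ
    K = proj₁ blockDigits-bounded

    N : ℕ
    N = r₀ + K

    blockDigits-length≤N : ∀ β → length (blockDigits β) ≤ N
    blockDigits-length≤N β = ℕ.≤-trans (proj₂ blockDigits-bounded β) (ℕ.m≤n+m K r₀)

    paddedBlock : Block → Vec (Fin k′) N
    paddedBlock β = padRight (blockDigits-length≤N β) z′ (fromList (blockDigits β))

    ⟦paddedBlock⟧ : ∀ β → Out.⟦ toList (paddedBlock β) ⟧ ≈ blockValue β
    ⟦paddedBlock⟧ β = begin
      Out.⟦ toList (paddedBlock β) ⟧            ≈⟨ Out₀.⟦padRight⟧ (blockDigits-length≤N β)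
                                                                     (fromList (blockDigits β)) ⟩
      Out.⟦ toList (fromList (blockDigits β)) ⟧ ≡⟨ ≡.cong Out.⟦_⟧ (toList∘fromList (blockDigits β)) ⟩
      Out.⟦ blockDigits β ⟧                     ≈⟨ proj₂ (spans (blockValue β)) ⟩
      blockValue β                              ∎

    flush : Vec (Fin k′) N → Block → Vec (Fin k′) (r + K)
    flush buf β = addWithCarry z′ buf (paddedBlock β)

    ⟦flush⟧ : ∀ buf β → Out.⟦ toList (flush buf β) ⟧ ≈ Out.⟦ toList buf ⟧ ∙ blockValue β
    ⟦flush⟧ buf β = begin
      Out.⟦ toList (flush buf β) ⟧
        ≈⟨ ⟦addWithCarry⟧ z′ buf (paddedBlock β) ⟩
      Sig′ z′ ∙ Out.⟦ toList buf ⟧ ∙ Out.⟦ toList (paddedBlock β) ⟧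
        ≈⟨ ∙-cong (trans (∙-congʳ (proj₂ hasZero)) (identityˡ _)) (⟦paddedBlock⟧ β) ⟩
      Out.⟦ toList buf ⟧ ∙ blockValue β ∎

    emitted : Vec (Fin k′) N → Block → List (Fin k′)
    emitted buf β = toList (take r (flush buf β))

    carried : Vec (Fin k′) N → Block → Vec (Fin k′) N
    carried buf β = padRight (ℕ.m≤n+m K r₀) z′ (drop r (flush buf β))

    State : Set
    State = Fin (DFA.states M′) × Fin n × Block × Vec (Fin k′) N

    State-finite : Finite State
    State-finite = ×-finite (Fin-finite _) (×-finite (Fin-finite n)
                     (×-finite (Vec-finite (Fin-finite k) n) (Vec-finite (Fin-finite k′) N)))

    nextState : Fin (DFA.states M′) → (m : Fin n) → Block → Vec (Fin k′) N →
                Dec (suc (toℕ m) < n) → State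
    nextState q m β buf (yes m+1<n) = q , fromℕ< m+1<n , β , buf
    nextState q m β buf (no _)      = DFA.run M′ q (emitted buf β) , zero , replicate n z , carried buf β

    transducer : Automaton k State
    transducer = record
      { start  = DFA.start M′ , zero , replicate n z , replicate N z′
      ; step   = λ { (q , m , β , buf) s → nextState q m (β [ m ]≔ s) buf (suc (toℕ m) <? n) }
      ; accept = λ { (q , m , β , buf) → DFA.accept M′ (DFA.run M′ q (toList (flush buf β))) }
      }

    open Automaton transducer using (run; accept; Accepts)

    pending : ℕ → Block → Vec (Fin k′) N → G₀ → G₀
    pending j β buf x = Out.⟦ toList buf ⟧ ∙ blockValue β ∙ iter Fʳ j x

    pending-start : ∀ x → pending 0 (replicate n z) (replicate N z′) x ≈ x
    pending-start x = begin
      Out.⟦ toList (replicate N z′) ⟧ ∙ blockValue (replicate n z) ∙ x ≈⟨ ∙-congʳ (∙-cong (Out₀.⟦replicate⟧ N)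
                                                                                          (In₀.⟦replicate⟧ n)) ⟩
      ε ∙ ε ∙ x                                                       ≈⟨ trans (∙-congʳ (identityˡ ε)) (identityˡ x) ⟩
      x                                                               ∎

    Unfilled : Fin n → Block → Set
    Unfilled m β = ∀ i → toℕ m ≤ toℕ i → lookup β i ≡ z

    replicate-unfilled : Unfilled zero (replicate n z)
    replicate-unfilled i _ = lookup-replicate i z

    Unfilled-≔ : ∀ m β s (m+1<n : suc (toℕ m) < n) → Unfilled m β →
                 Unfilled (fromℕ< m+1<n) (β [ m ]≔ s)
    Unfilled-≔ m β s m+1<n unfilled i m+1≤i =
      ≡.trans (lookup∘update′ (≢-sym (<⇒≢ m<i)) β s) (unfilled i (ℕ.<⇒≤ m<i))
      where
      m<i : toℕ m < toℕ i
      m<i = ≡.subst (_≤ toℕ i) (toℕ-fromℕ< m+1<n) m+1≤i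

    pending-∷ : ∀ m β buf s w → Unfilled m β →
                pending (toℕ m) β buf In.⟦ s ∷ w ⟧ ≈ pending (suc (toℕ m)) (β [ m ]≔ s) buf In.⟦ w ⟧
    pending-∷ m β buf s w unfilled = begin
      b ∙ blockValue β ∙ iter Fʳ j In.⟦ s ∷ w ⟧                          ≈⟨ ∙-congˡ (In.iter-⟦∷⟧ j s w) ⟩
      b ∙ blockValue β ∙ (iter Fʳ j (Sig s) ∙ iter Fʳ (suc j) In.⟦ w ⟧) ≈⟨ assoc _ _ _ ⟨
      b ∙ blockValue β ∙ iter Fʳ j (Sig s) ∙ iter Fʳ (suc j) In.⟦ w ⟧   ≈⟨ ∙-congʳ (assoc _ _ _) ⟩
      b ∙ (blockValue β ∙ iter Fʳ j (Sig s)) ∙ iter Fʳ (suc j) In.⟦ w ⟧ ≈⟨ ∙-congʳ (∙-congˡ fill) ⟨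
      b ∙ blockValue (β [ m ]≔ s) ∙ iter Fʳ (suc j) In.⟦ w ⟧            ∎
      where
      b : G₀
      b = Out.⟦ toList buf ⟧
      j : ℕ
      j = toℕ m
      fill : blockValue (β [ m ]≔ s) ≈ blockValue β ∙ iter Fʳ j (Sig s)
      fill = In₀.evalFrom-≔ 0 β m s (unfilled m ℕ.≤-refl)

    ⟦emitted++⟧ : ∀ buf β x ω → Out.⟦ ω ⟧ ≈ pending 0 (replicate n z) (carried buf β) x →
                  Out.⟦ emitted buf β ++ ω ⟧ ≈ pending n β buf x
    ⟦emitted++⟧ buf β x ω ⟦ω⟧≈ = begin
      Out.⟦ out ++ ω ⟧                                   ≈⟨ Out.⟦++⟧ out ω ⟩
      Out.⟦ out ⟧ ∙ iter Fⁿ (length out) Out.⟦ ω ⟧       ≡⟨ ≡.cong (λ l → Out.⟦ out ⟧ ∙ iter Fⁿ l Out.⟦ ω ⟧)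
                                                                    (length-toList (take r ds)) ⟩
      Out.⟦ out ⟧ ∙ iter Fⁿ r Out.⟦ ω ⟧                  ≈⟨ ∙-congˡ (Fⁿʳ.⟦⟧-cong (trans ⟦ω⟧≈ rest≈)) ⟩
      Out.⟦ out ⟧ ∙ iter Fⁿ r (Out.⟦ rest ⟧ ∙ x)         ≈⟨ ∙-congˡ (Fⁿʳ.homo _ _) ⟩
      Out.⟦ out ⟧ ∙ (iter Fⁿ r Out.⟦ rest ⟧ ∙ iter Fⁿ r x) ≈⟨ assoc _ _ _ ⟨
      Out.⟦ out ⟧ ∙ iter Fⁿ r Out.⟦ rest ⟧ ∙ iter Fⁿ r x ≈⟨ ∙-congʳ (Out.⟦take⟧∙⟦drop⟧ r ds) ⟩
      Out.⟦ toList ds ⟧ ∙ iter Fⁿ r x                    ≈⟨ ∙-congʳ (⟦flush⟧ buf β) ⟩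
      Out.⟦ toList buf ⟧ ∙ blockValue β ∙ iter Fⁿ r x    ≡⟨ ≡.cong (Out.⟦ toList buf ⟧ ∙ blockValue β ∙_)
                                                                    (iter-iter-comm F n r x) ⟩
      pending n β buf x                                  ∎
      where
      ds : Vec (Fin k′) (r + K)
      ds = flush buf β
      out rest : List (Fin k′)
      out = emitted buf β
      rest = toList (drop r ds)
      rest≈ : pending 0 (replicate n z) (carried buf β) x ≈ Out.⟦ rest ⟧ ∙ x
      rest≈ = ∙-congʳ (trans (∙-cong (Out₀.⟦padRight⟧ (ℕ.m≤n+m K r₀) (drop r ds)) (In₀.⟦replicate⟧ n))
                             (identityʳ _))

    simulate : ∀ w q m β buf → Unfilled m β → Σ (List (Fin k′)) λ ω →
               accept (run (q , m , β , buf) w) ≡ DFA.accept M′ (DFA.run M′ q ω) ×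
               Out.⟦ ω ⟧ ≈ pending (toℕ m) β buf In.⟦ w ⟧
    simulate [] q m β buf _ = toList (flush buf β) , ≡.refl , (begin
      Out.⟦ toList (flush buf β) ⟧          ≈⟨ ⟦flush⟧ buf β ⟩
      Out.⟦ toList buf ⟧ ∙ blockValue β     ≈⟨ identityʳ _ ⟨
      Out.⟦ toList buf ⟧ ∙ blockValue β ∙ ε ≈⟨ ∙-congˡ Fʳᵐ.ε-homo ⟨
      pending (toℕ m) β buf ε               ∎)
      where module Fʳᵐ = IsMonoidHomomorphism (iter-isMonoidHomomorphism Fʳ-homo (toℕ m))
    simulate (s ∷ w) q m β buf unfilled with suc (toℕ m) <? n
    ... | yes m+1<n with simulate w q (fromℕ< m+1<n) (β [ m ]≔ s) buf (Unfilled-≔ m β s m+1<n unfilled)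
    ...   | ω , accepts , ⟦ω⟧≈ = ω , accepts , (begin
      Out.⟦ ω ⟧                                              ≈⟨ ⟦ω⟧≈ ⟩
      pending (toℕ (fromℕ< m+1<n)) (β [ m ]≔ s) buf In.⟦ w ⟧ ≡⟨ ≡.cong (λ j → pending j (β [ m ]≔ s) buf In.⟦ w ⟧)
                                                                        (toℕ-fromℕ< m+1<n) ⟩
      pending (suc (toℕ m)) (β [ m ]≔ s) buf In.⟦ w ⟧        ≈⟨ pending-∷ m β buf s w unfilled ⟨
      pending (toℕ m) β buf In.⟦ s ∷ w ⟧                     ∎)
    simulate (s ∷ w) q m β buf unfilled | no m+1≮n
      with simulate w (DFA.run M′ q (emitted buf (β [ m ]≔ s))) zero (replicate n z) (carried buf (β [ m ]≔ s))
                    replicate-unfilled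
    ... | ω , accepts , ⟦ω⟧≈ =
      emitted buf (β [ m ]≔ s) ++ ω ,
      ≡.trans accepts (≡.cong (DFA.accept M′) (≡.sym (DFA-run-++ M′ q (emitted buf (β [ m ]≔ s)) ω))) ,
      (begin
        Out.⟦ emitted buf (β [ m ]≔ s) ++ ω ⟧            ≈⟨ ⟦emitted++⟧ buf (β [ m ]≔ s) In.⟦ w ⟧ ω ⟦ω⟧≈ ⟩
        pending n (β [ m ]≔ s) buf In.⟦ w ⟧              ≡⟨ ≡.cong (λ j → pending j (β [ m ]≔ s) buf In.⟦ w ⟧)
                                                                   (ℕ.≤∧≮⇒≡ (toℕ<n m) m+1≮n) ⟨
        pending (suc (toℕ m)) (β [ m ]≔ s) buf In.⟦ w ⟧  ≈⟨ pending-∷ m β buf s w unfilled ⟨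
        pending (toℕ m) β buf In.⟦ s ∷ w ⟧               ∎)

    Lang⇔Accepts : ∀ w → Lang Γ F r Sig A w ⇔ Accepts w
    Lang⇔Accepts w with simulate w (DFA.start M′) zero (replicate n z) (replicate N z′) replicate-unfilled
    ... | ω , accepts , ⟦ω⟧≈ =
      mk⇔ (≡.trans accepts) (≡.trans (≡.sym accepts))
        ⇔-∘ (M′-recognises ω ⇔-∘ mk⇔ (A-resp (sym ⟦ω⟧≈⟦w⟧)) (A-resp ⟦ω⟧≈⟦w⟧))
      where
      ⟦ω⟧≈⟦w⟧ : Out.⟦ ω ⟧ ≈ In.⟦ w ⟧
      ⟦ω⟧≈⟦w⟧ = trans ⟦ω⟧≈ (pending-start In.⟦ w ⟧)

    Lang-isRegular : IsRegular (Lang Γ F r Sig A)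
    Lang-isRegular = isRegular-resp-⇔ Lang⇔Accepts (finite-automaton-isRegular State-finite transducer)

proposition2p6 : {c ℓ p : Level} (Γ : AbelianGroup c ℓ)
    (F : AbelianGroup.Carrier Γ → AbelianGroup.Carrier Γ)
    (A : AbelianGroup.Carrier Γ → Set p) →
    IsInfinite Γ → IsInjectiveEndo Γ F → RespectsEq Γ A →
    IsAutomatic Γ F A →
    (r : ℕ) → 0 < r → {k : ℕ} (Sig : Fin k → AbelianGroup.Carrier Γ) →
    IsEnumeration Γ Sig → IsSpanning Γ (iter F r) Sig →
    IsRegular (Lang Γ F r Sig A)
proposition2p6 Γ F A _ F-mono A-resp (suc n₀ , s≤s z≤n , _ , _ , _ , Sig′-spanning , M′ , M′-recognises)
               (suc r₀) (s≤s z≤n) Sig _ Sig-spanning with IsSpanning.hasZero Sig-spanning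
... | z , z≈ε =
  BaseChange.Lang-isRegular Γ (GroupMorphisms.IsGroupMonomorphism.isMonoidHomomorphism F-mono) A-resp
    n₀ Sig′-spanning M′ M′-recognises r₀ Sig z z≈ε
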